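{- Let $n,t$ be positive integers with $n\geq \max\{5,2t\}$, and let $H=K_t\vee(K_{n-2t}\cup tK_1)$ if $n\geq 2t+1$, and $H=K_t\vee tK_1$ if $n=2t$. Then $H$ has a spanning tree with leaf distance at least four.
   Context: $K_m$ is the complete graph on $m$ vertices, $tK_1$ is $t$ isolated vertices, $\cup$ is disjoint union, and $G_1\vee G_2$ is the join (disjoint union plus all edges between $V(G_1)$ and $V(G_2)$). The leaf distance of a tree is the minimum distance in the tree between two distinct leaves (vertices of degree one). -}

module Defs where

open import Data.Nat using (ℕ; zero; suc; _+_; _<_; _≤_)
open import Data.Nat.Properties using (_<?_)
open import Data.Bool using (Bool; true; false; if_then_else_; _∧_; _∨_; not)
open import Data.Fin using (Fin; toℕ; inject₁; fromℕ; _≟_)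
import Data.Fin as F
open import Data.List using (List; map; allFin)
open import Data.Nat.ListAction using (sum)
open import Data.Product using (Σ; ∃; _×_; _,_)
open import Relation.Nullary using (¬_; yes; no)
open import Data.Empty using (⊥-elim)
open import Data.Bool.Properties using (∧-comm)
open import Relation.Nullary.Decidable using (⌊_⌋)
open import Relation.Binary.PropositionalEquality using (_≡_; refl) renaming (sym to sym≡)
open import Function.Definitions using (Injective)

record Graph (n : ℕ) : Set where
  field
    adj   : Fin n → Fin n → Bool
    sym   : ∀ u v → adj u v ≡ adj v u
    irrefl : ∀ v → adj v v ≡ false
open Graph public

-- Vertex classes of H = K_t ∨ (K_{n-2t} ∪ tK_1) on Fin n:
--   vertices 0 .. t-1           : the clique K_t
--   vertices t .. n-t-1         : the clique K_{n-2t}  (empty when n = 2t)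
--   vertices n-t .. n-1         : the t isolated vertices tK_1
inKt : (n t : ℕ) → Fin n → Bool
inKt n t v = ⌊ toℕ v <? t ⌋

inMid : (n t : ℕ) → Fin n → Bool
inMid n t v = not (inKt n t v) ∧ ⌊ toℕ v + t <? n ⌋

Hadj : (n t : ℕ) → Fin n → Fin n → Bool
Hadj n t u v =
  not ⌊ u ≟ v ⌋ ∧ (inKt n t u ∨ inKt n t v ∨ (inMid n t u ∧ inMid n t v))

data Walk {n : ℕ} (A : Fin n → Fin n → Bool) : ℕ → Fin n → Fin n → Set where
  here : ∀ {v} → Walk A zero v v
  step : ∀ {k u w v} → A u w ≡ true → Walk A k w v → Walk A (suc k) u v

Connected : {n : ℕ} → Graph n → Set
Connected G = ∀ u v → ∃ λ k → Walk (adj G) k u v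

HasCycle : {n : ℕ} → Graph n → Set
HasCycle {n} G =
  Σ ℕ λ m → Σ (Fin (suc (suc (suc m))) → Fin n) λ c →
    Injective _≡_ _≡_ c ×
    (∀ (i : Fin (suc (suc m))) → adj G (c (inject₁ i)) (c (F.suc i)) ≡ true) ×
    adj G (c (fromℕ (suc (suc m)))) (c F.zero) ≡ true

IsTree : {n : ℕ} → Graph n → Set
IsTree G = Connected G × ¬ HasCycle G

-- T is a subgraph of G (same vertex set, hence spanning)
SubgraphOf : {n : ℕ} → Graph n → Graph n → Set
SubgraphOf T G = ∀ u v → adj T u v ≡ true → adj G u v ≡ true

degree : {n : ℕ} → Graph n → Fin n → ℕ
degree {n} G v = sum (map (λ u → if adj G v u then 1 else 0) (allFin n))

IsLeaf : {n : ℕ} → Graph n → Fin n → Set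
IsLeaf G v = degree G v ≡ 1

DistAtLeast : {n : ℕ} → Graph n → ℕ → Fin n → Fin n → Set
DistAtLeast G d u v = ∀ k → k < d → ¬ Walk (adj G) k u v

LeafDistAtLeast : {n : ℕ} → Graph n → ℕ → Set
LeafDistAtLeast G d = ∀ u v → ¬ u ≡ v → IsLeaf G u → IsLeaf G v → DistAtLeast G d u v

HasSpanningTreeLeafDist : {n : ℕ} → Graph n → ℕ → Set
HasSpanningTreeLeafDist {n} G d =
  Σ (Graph n) λ T → SubgraphOf T G × IsTree T × LeafDistAtLeast T d

private
  ≟-sym : ∀ {n} (u v : Fin n) → ⌊ u ≟ v ⌋ ≡ ⌊ v ≟ u ⌋
  ≟-sym u v with u ≟ v | v ≟ u
  ... | yes _ | yes _ = refl
  ... | no _  | no _  = refl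
  ... | yes p | no q  = ⊥-elim (q (sym≡ p))
  ... | no p  | yes q = ⊥-elim (p (sym≡ q))

  bsym : ∀ a b c d e → not a ∧ (b ∨ c ∨ (d ∧ e)) ≡ not a ∧ (c ∨ b ∨ (e ∧ d))
  bsym a false false d e rewrite ∧-comm d e = refl
  bsym a false true d e = refl
  bsym a true false d e = refl
  bsym a true true d e = refl

  ≟-refl : ∀ {n} (v : Fin n) → ⌊ v ≟ v ⌋ ≡ true
  ≟-refl v with v ≟ v
  ... | yes _ = refl
  ... | no p = ⊥-elim (p refl)

Hadj-sym : (n t : ℕ) → ∀ u v → Hadj n t u v ≡ Hadj n t v u
Hadj-sym n t u v rewrite ≟-sym u v =
  bsym ⌊ v ≟ u ⌋ (inKt n t u) (inKt n t v) (inMid n t u) (inMid n t v)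

Hadj-irrefl : (n t : ℕ) → ∀ v → Hadj n t v v ≡ false
Hadj-irrefl n t v rewrite ≟-refl v = refl

H : (n t : ℕ) → Graph n
H n t = record { adj = Hadj n t ; sym = Hadj-sym n t ; irrefl = Hadj-irrefl n t }

-- A Hamiltonian path is a spanning tree whose only leaves are its two ends, and these are
-- at distance n - 1 ≥ 4 in it. The graph H has a Hamiltonian path: run through the clique
-- K_{n-2t} first, then alternate between K_t and the isolated vertices, using each vertex
-- of K_t to step from one isolated vertex to the next.
module Submission where

open import Defs hiding (sym)
open import Data.Bool using (Bool; true; false; if_then_else_)
open import Data.Bool.Properties using (∨-zeroʳ)
open import Data.Fin as Fin using (Fin; zero; suc; toℕ; inject₁; fromℕ; fromℕ<; punchOut)
import Data.Fin.Properties as Finₚ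
open import Data.List using (tabulate)
open import Data.List.Properties using (map-tabulate)
open import Data.Nat using (ℕ; zero; suc; pred; s≤s; ≢-nonZero; _+_; _*_; _∸_; _≤_; _<_; ∣_-_∣; _≟_; _<?_)
open import Data.Nat.ListAction using (sum)
open import Data.Nat.Properties
open import Data.Product using (∃; _×_; _,_)
open import Data.Sum as Sum using (_⊎_; inj₁; inj₂)
open import Function using (_∘_; id)
open import Function.Definitions using (Injective)
open import Relation.Nullary using (¬_; Dec; yes; no; contradiction)
open import Relation.Nullary.Decidable using (⌊_⌋; dec-true; dec-false; isYes≗does)
open import Relation.Binary.PropositionalEquality

⌊⌋-true : ∀ {A : Set} (a? : Dec A) → A → ⌊ a? ⌋ ≡ true
⌊⌋-true a? a = trans (isYes≗does a?) (dec-true a? a)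

⌊⌋-false : ∀ {A : Set} (a? : Dec A) → ¬ A → ⌊ a? ⌋ ≡ false
⌊⌋-false a? ¬a = trans (isYes≗does a?) (dec-false a? ¬a)

⌊⌋-true⁻¹ : ∀ {A : Set} (a? : Dec A) → ⌊ a? ⌋ ≡ true → A
⌊⌋-true⁻¹ (yes a) _ = a
⌊⌋-true⁻¹ (no _) ()

∣m-1+m∣≡1 : ∀ m → ∣ m - suc m ∣ ≡ 1
∣m-1+m∣≡1 zero = refl
∣m-1+m∣≡1 (suc m) = ∣m-1+m∣≡1 m

∣m-n∣≡1⇒1+m≡n⊎1+n≡m : ∀ {m n} → ∣ m - n ∣ ≡ 1 → suc m ≡ n ⊎ suc n ≡ m
∣m-n∣≡1⇒1+m≡n⊎1+n≡m {zero} e = inj₁ (sym e)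
∣m-n∣≡1⇒1+m≡n⊎1+n≡m {suc m} {zero} e = inj₂ (sym e)
∣m-n∣≡1⇒1+m≡n⊎1+n≡m {suc m} {suc n} e = Sum.map (cong suc) (cong suc) (∣m-n∣≡1⇒1+m≡n⊎1+n≡m e)

-- A missed value y could be punched out, giving an injection Fin (suc n) → Fin n.
injective⇒surjective : ∀ {n} {f : Fin n → Fin n} → Injective _≡_ _≡_ f → ∀ y → ∃ λ x → f x ≡ y
injective⇒surjective {suc n} {f} f-injective y with Finₚ.any? (λ x → f x Fin.≟ y)
... | yes hit = hit
... | no miss = contradiction (Finₚ.injective⇒≤ f-avoiding-y-injective) 1+n≰n
  where
  y≢f : ∀ x → y ≢ f x
  y≢f x y≡fx = miss (x , sym y≡fx)

  f-avoiding-y : Fin (suc n) → Fin n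
  f-avoiding-y x = punchOut (y≢f x)

  f-avoiding-y-injective : Injective _≡_ _≡_ f-avoiding-y
  f-avoiding-y-injective {x} {x′} e = f-injective (Finₚ.punchOut-injective (y≢f x) (y≢f x′) e)

UnitSteps : ∀ {N} → (Fin (suc N) → ℕ) → Set
UnitSteps g = ∀ i → ∣ g (inject₁ i) - g (suc i) ∣ ≡ 1

-- Injectivity forbids turning back, so the first step fixes the direction of all others.
unitSteps-ascending : ∀ {N} (g : Fin (suc (suc N)) → ℕ) → Injective _≡_ _≡_ g → UnitSteps g →
                      suc (g zero) ≡ g (suc zero) → g (fromℕ (suc N)) ≡ g zero + suc N
unitSteps-ascending {zero} g _ _ up = trans (sym up) (+-comm 1 (g zero))
unitSteps-ascending {suc N} g g-injective steps up = begin
  g (fromℕ (suc (suc N)))  ≡⟨ unitSteps-ascending (g ∘ suc) (Finₚ.suc-injective ∘ g-injective) (steps ∘ suc) next ⟩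
  g (suc zero) + suc N     ≡⟨ cong (_+ suc N) (sym up) ⟩
  suc (g zero + suc N)     ≡⟨ sym (+-suc (g zero) (suc N)) ⟩
  g zero + suc (suc N)     ∎
  where
  open ≡-Reasoning
  next : suc (g (suc zero)) ≡ g (suc (suc zero))
  next with ∣m-n∣≡1⇒1+m≡n⊎1+n≡m (steps (suc zero))
  ... | inj₁ forward = forward
  ... | inj₂ back = contradiction (g-injective (suc-injective (trans back (sym up)))) λ ()

unitSteps-descending : ∀ {N} (g : Fin (suc (suc N)) → ℕ) → Injective _≡_ _≡_ g → UnitSteps g →
                       suc (g (suc zero)) ≡ g zero → g (fromℕ (suc N)) + suc N ≡ g zero
unitSteps-descending {zero} g _ _ down = trans (+-comm (g (suc zero)) 1) down
unitSteps-descending {suc N} g g-injective steps down = begin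
  g (fromℕ (suc (suc N))) + suc (suc N)  ≡⟨ +-suc (g (fromℕ (suc (suc N)))) (suc N) ⟩
  suc (g (fromℕ (suc (suc N))) + suc N)  ≡⟨ cong suc (unitSteps-descending (g ∘ suc) (Finₚ.suc-injective ∘ g-injective) (steps ∘ suc) next) ⟩
  suc (g (suc zero))                     ≡⟨ down ⟩
  g zero                                 ∎
  where
  open ≡-Reasoning
  next : suc (g (suc (suc zero))) ≡ g (suc zero)
  next with ∣m-n∣≡1⇒1+m≡n⊎1+n≡m (steps (suc zero))
  ... | inj₂ back = back
  ... | inj₁ forward = contradiction (g-injective (trans (sym forward) down)) λ ()

unitSteps-∣first-last∣ : ∀ {N} (g : Fin (suc N) → ℕ) → Injective _≡_ _≡_ g → UnitSteps g →
                         ∣ g zero - g (fromℕ N) ∣ ≡ N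
unitSteps-∣first-last∣ {zero} g _ _ = ∣n-n∣≡0 (g zero)
unitSteps-∣first-last∣ {suc N} g g-injective steps with ∣m-n∣≡1⇒1+m≡n⊎1+n≡m (steps zero)
... | inj₁ up = begin
  ∣ g zero - g (fromℕ (suc N)) ∣   ≡⟨ cong ∣ g zero -_∣ (unitSteps-ascending g g-injective steps up) ⟩
  ∣ g zero - g zero + suc N ∣      ≡⟨ ∣m-m+n∣≡n (g zero) (suc N) ⟩
  suc N                            ∎
  where open ≡-Reasoning
... | inj₂ down = begin
  ∣ g zero - last ∣                ≡⟨ cong ∣_- last ∣ (sym (unitSteps-descending g g-injective steps down)) ⟩
  ∣ last + suc N - last ∣          ≡⟨ ∣-∣-comm (last + suc N) last ⟩
  ∣ last - last + suc N ∣          ≡⟨ ∣m-m+n∣≡n last (suc N) ⟩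
  suc N                            ∎
  where
  open ≡-Reasoning
  last = g (fromℕ (suc N))

module _ {n : ℕ} {A : Fin n → Fin n → Bool} where

  _++ʷ_ : ∀ {k l u w v} → Walk A k u w → Walk A l w v → Walk A (k + l) u v
  here ++ʷ q = q
  step e p ++ʷ q = step e (p ++ʷ q)

  snocʷ : ∀ {k u w v} → Walk A k u w → A w v ≡ true → Walk A (suc k) u v
  snocʷ here e = step e here
  snocʷ (step e′ p) e = step e′ (snocʷ p e)

reverseʷ : ∀ {n} (G : Graph n) {k u v} → Walk (adj G) k u v → Walk (adj G) k v u
reverseʷ G here = here
reverseʷ G (step {u = u} {w = w} e p) = snocʷ (reverseʷ G p) (trans (Graph.sym G w u) e)

≤-sum-tabulate : ∀ {n} (f : Fin n → ℕ) a → f a ≤ sum (tabulate f)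
≤-sum-tabulate f zero = m≤m+n (f zero) _
≤-sum-tabulate f (suc a) = m≤n⇒m≤o+n (f zero) (≤-sum-tabulate (f ∘ suc) a)

pair≤sum-tabulate : ∀ {n} (f : Fin n → ℕ) {a b} → a ≢ b → f a + f b ≤ sum (tabulate f)
pair≤sum-tabulate f {zero} {zero} a≢b = contradiction refl a≢b
pair≤sum-tabulate f {zero} {suc b} _ = +-monoʳ-≤ (f zero) (≤-sum-tabulate (f ∘ suc) b)
pair≤sum-tabulate f {suc a} {zero} _ =
  subst (_≤ sum (tabulate f)) (+-comm (f zero) (f (suc a))) (+-monoʳ-≤ (f zero) (≤-sum-tabulate (f ∘ suc) a))
pair≤sum-tabulate f {suc a} {suc b} a≢b = m≤n⇒m≤o+n (f zero) (pair≤sum-tabulate (f ∘ suc) (a≢b ∘ cong suc))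

two-neighbours⇒¬leaf : ∀ {n} (G : Graph n) {v a b} → a ≢ b → adj G v a ≡ true → adj G v b ≡ true →
                       ¬ IsLeaf G v
two-neighbours⇒¬leaf {n} G {v} {a} {b} a≢b va vb leaf = 1+n≰n (begin
  2                      ≡⟨ cong₂ _+_ (sym (counted va)) (sym (counted vb)) ⟩
  f a + f b              ≤⟨ pair≤sum-tabulate f a≢b ⟩
  sum (tabulate f)       ≡⟨ cong sum (sym (map-tabulate id f)) ⟩
  degree G v             ≡⟨ leaf ⟩
  1                      ∎)
  where
  open ≤-Reasoning
  f : Fin n → ℕ
  f u = if adj G v u then 1 else 0
  counted : ∀ {u} → adj G v u ≡ true → f u ≡ 1
  counted e rewrite e = refl

hasSpanningTreeLeafDist-mono : ∀ {n} {G : Graph n} {d e} → d ≤ e →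
                               HasSpanningTreeLeafDist G e → HasSpanningTreeLeafDist G d
hasSpanningTreeLeafDist-mono d≤e (T , T⊆G , T-tree , far) =
  T , T⊆G , T-tree , λ u v u≢v u-leaf v-leaf k k<d → far u v u≢v u-leaf v-leaf k (<-≤-trans k<d d≤e)

module PathGraph {n : ℕ} (pos : Fin n → ℕ) where

  pathAdj : Fin n → Fin n → Bool
  pathAdj u v = ⌊ ∣ pos u - pos v ∣ ≟ 1 ⌋

  pathAdj-sym : ∀ u v → pathAdj u v ≡ pathAdj v u
  pathAdj-sym u v = cong (λ d → ⌊ d ≟ 1 ⌋) (∣-∣-comm (pos u) (pos v))

  pathAdj-irrefl : ∀ v → pathAdj v v ≡ false
  pathAdj-irrefl v rewrite ∣n-n∣≡0 (pos v) = refl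

  pathGraph : Graph n
  pathGraph = record { adj = pathAdj ; sym = pathAdj-sym ; irrefl = pathAdj-irrefl }

  pathAdj⇒∣pos-pos∣≡1 : ∀ {u v} → pathAdj u v ≡ true → ∣ pos u - pos v ∣ ≡ 1
  pathAdj⇒∣pos-pos∣≡1 = ⌊⌋-true⁻¹ _

  successor⇒pathAdj : ∀ {u v} → suc (pos u) ≡ pos v → pathAdj u v ≡ true
  successor⇒pathAdj {u} {v} e =
    ⌊⌋-true (∣ pos u - pos v ∣ ≟ 1) (subst (λ p → ∣ pos u - p ∣ ≡ 1) e (∣m-1+m∣≡1 (pos u)))

  predecessor⇒pathAdj : ∀ {u v} → suc (pos v) ≡ pos u → pathAdj u v ≡ true
  predecessor⇒pathAdj {u} {v} e = trans (pathAdj-sym u v) (successor⇒pathAdj e)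

  walk⇒∣pos-pos∣≤ : ∀ {k u v} → Walk pathAdj k u v → ∣ pos u - pos v ∣ ≤ k
  walk⇒∣pos-pos∣≤ {v = v} here = ≤-reflexive (∣n-n∣≡0 (pos v))
  walk⇒∣pos-pos∣≤ {suc k} {u} {v} (step {w = w} e p) = begin
    ∣ pos u - pos v ∣                      ≤⟨ ∣-∣-triangle (pos u) (pos w) (pos v) ⟩
    ∣ pos u - pos w ∣ + ∣ pos w - pos v ∣  ≤⟨ +-mono-≤ (≤-reflexive (pathAdj⇒∣pos-pos∣≡1 e)) (walk⇒∣pos-pos∣≤ p) ⟩
    suc k                                  ∎
    where open ≤-Reasoning

  -- Along a cycle the positions would be an injective unit-step sequence, which must end
  -- at distance m + 2 from where it started, yet the closing edge needs distance 1.
  pathGraph-acyclic : Injective _≡_ _≡_ pos → ¬ HasCycle pathGraph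
  pathGraph-acyclic pos-injective (m , c , c-injective , steps , closing) =
    1+n≢0 (suc-injective (begin
      suc (suc m)                                ≡⟨ unitSteps-∣first-last∣ g g-injective (pathAdj⇒∣pos-pos∣≡1 ∘ steps) ⟨
      ∣ g zero - g (fromℕ (suc (suc m))) ∣       ≡⟨ ∣-∣-comm (g zero) _ ⟩
      ∣ g (fromℕ (suc (suc m))) - g zero ∣       ≡⟨ pathAdj⇒∣pos-pos∣≡1 closing ⟩
      1                                          ∎))
    where
    open ≡-Reasoning
    g = pos ∘ c
    g-injective : Injective _≡_ _≡_ g
    g-injective = c-injective ∘ pos-injective

record HamiltonianPath {n : ℕ} (G : Graph n) : Set where
  field
    pos           : Fin n → ℕ
    pos<n         : ∀ v → pos v < n
    pos-injective : Injective _≡_ _≡_ pos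
    successor-adj : ∀ {u v} → suc (pos u) ≡ pos v → adj G u v ≡ true

module _ {n : ℕ} {G : Graph n} (path : HamiltonianPath G) where
  open HamiltonianPath path
  open PathGraph pos

  pos-surjective : ∀ p → p < n → ∃ λ v → pos v ≡ p
  pos-surjective p p<n with injective⇒surjective {f = λ v → fromℕ< (pos<n v)}
                              (pos-injective ∘ Finₚ.fromℕ<-injective _ _ _ _) (fromℕ< p<n)
  ... | v , e = v , Finₚ.fromℕ<-injective _ _ _ _ e

  pathGraph⊆G : SubgraphOf pathGraph G
  pathGraph⊆G u v e with ∣m-n∣≡1⇒1+m≡n⊎1+n≡m (pathAdj⇒∣pos-pos∣≡1 e)
  ... | inj₁ u→v = successor-adj u→v
  ... | inj₂ v→u = trans (Graph.sym G u v) (successor-adj v→u)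

  walk-to-start : ∀ p u → pos u ≡ p → ∃ λ s → pos s ≡ 0 × Walk pathAdj p u s
  walk-to-start zero u u↦0 = u , u↦0 , here
  walk-to-start (suc p) u u↦p+1 with pos-surjective p (<-trans (n<1+n p) (subst (_< n) u↦p+1 (pos<n u)))
  ... | w , w↦p with walk-to-start p w w↦p
  ...   | s , s↦0 , w⇝s = s , s↦0 , step (predecessor⇒pathAdj (trans (cong suc w↦p) (sym u↦p+1))) w⇝s

  pathGraph-connected : Connected pathGraph
  pathGraph-connected u v with walk-to-start _ u refl | walk-to-start _ v refl
  ... | s , s↦0 , u⇝s | s′ , s′↦0 , v⇝s′ with pos-injective (trans s↦0 (sym s′↦0))
  ...   | refl = _ , u⇝s ++ʷ reverseʷ pathGraph v⇝s′

  interior⇒¬leaf : ∀ {v} → pos v ≢ 0 → suc (pos v) ≢ n → ¬ IsLeaf pathGraph v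
  interior⇒¬leaf {v} ¬first ¬last
    with before , before↦ ← pos-surjective (pred (pos v)) (≤-<-trans pred[n]≤n (pos<n v))
       | after , after↦ ← pos-surjective (suc (pos v)) (≤∧≢⇒< (pos<n v) ¬last)
    = two-neighbours⇒¬leaf pathGraph
        (λ e → <⇒≢ (s≤s pred[n]≤n) (trans (sym before↦) (trans (cong pos e) after↦)))
        (predecessor⇒pathAdj (trans (cong suc before↦) (suc-pred (pos v) {{≢-nonZero ¬first}})))
        (successor⇒pathAdj (sym after↦))

  leaf⇒endpoint : ∀ {v} → IsLeaf pathGraph v → pos v ≡ 0 ⊎ suc (pos v) ≡ n
  leaf⇒endpoint {v} leaf with pos v ≟ 0 | suc (pos v) ≟ n
  ... | yes first | _ = inj₁ first
  ... | no _ | yes last = inj₂ last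
  ... | no ¬first | no ¬last = contradiction leaf (interior⇒¬leaf ¬first ¬last)

  start-end-distance : ∀ {s e} → pos s ≡ 0 → suc (pos e) ≡ n → pred n ≤ ∣ pos s - pos e ∣
  start-end-distance {e = e} s↦0 e↦last =
    ≤-reflexive (trans (cong pred (sym e↦last)) (cong ∣_- pos e ∣ (sym s↦0)))

  pathGraph-leafDist : LeafDistAtLeast pathGraph (pred n)
  pathGraph-leafDist u v u≢v u-leaf v-leaf k k<d u⇝v with leaf⇒endpoint u-leaf | leaf⇒endpoint v-leaf
  ... | inj₁ u↦0 | inj₁ v↦0 = u≢v (pos-injective (trans u↦0 (sym v↦0)))
  ... | inj₂ u↦last | inj₂ v↦last = u≢v (pos-injective (suc-injective (trans u↦last (sym v↦last))))
  ... | inj₁ u↦0 | inj₂ v↦last =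
    <⇒≱ k<d (≤-trans (start-end-distance u↦0 v↦last) (walk⇒∣pos-pos∣≤ u⇝v))
  ... | inj₂ u↦last | inj₁ v↦0 =
    <⇒≱ k<d (≤-trans (start-end-distance v↦0 u↦last)
                     (subst (_≤ k) (∣-∣-comm (pos u) (pos v)) (walk⇒∣pos-pos∣≤ u⇝v)))

  hamiltonianPath⇒spanningTreeLeafDist : HasSpanningTreeLeafDist G (pred n)
  hamiltonianPath⇒spanningTreeLeafDist =
    pathGraph , pathGraph⊆G , (pathGraph-connected , pathGraph-acyclic pos-injective) , pathGraph-leafDist

module _ (t r : ℕ) where

  private
    n : ℕ
    n = r + 2 * t

  t+r+t≡n : t + r + t ≡ n
  t+r+t≡n = begin
    t + r + t    ≡⟨ cong (_+ t) (+-comm t r) ⟩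
    r + t + t    ≡⟨ +-assoc r t t ⟩
    r + (t + t)  ≡⟨ cong (λ s → r + (t + s)) (sym (+-identityʳ t)) ⟩
    n            ∎
    where open ≡-Reasoning

  data Part (x : ℕ) : Set where
    clique   : x < t → Part x
    middle   : ∀ j → j < r → x ≡ t + j → Part x
    isolated : ∀ i → i < t → x ≡ t + r + i → Part x

  part : ∀ x → x < n → Part x
  part x x<n with x <? t | x <? t + r
  ... | yes x<t | _ = clique x<t
  ... | no x≮t | yes x<t+r =
    middle (x ∸ t) (subst (x ∸ t <_) (m+n∸m≡n t r) (∸-monoˡ-< x<t+r (≮⇒≥ x≮t)))
                   (sym (m+[n∸m]≡n (≮⇒≥ x≮t)))
  ... | no _ | no x≮t+r =
    isolated (x ∸ (t + r)) (subst (x ∸ (t + r) <_) (m+n∸m≡n (t + r) t)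
                                  (∸-monoˡ-< (subst (x <_) (sym t+r+t≡n) x<n) (≮⇒≥ x≮t+r)))
                           (sym (m+[n∸m]≡n (≮⇒≥ x≮t+r)))

  -- The path visits the middle clique at positions 0 .. r-1 and then alternates
  -- clique vertex i (at r + 2i) with isolated vertex i (at r + 2i + 1).
  position : ∀ {x} → Part x → ℕ
  position {x} (clique _) = r + 2 * x
  position (middle j _ _) = j
  position (isolated i _ _) = r + suc (2 * i)

  position<n : ∀ {x} (a : Part x) → position a < n
  position<n (clique x<t) = +-monoʳ-< r (*-monoʳ-< 2 x<t)
  position<n (middle _ j<r _) = <-≤-trans j<r (m≤m+n r (2 * t))
  position<n (isolated i i<t _) = +-monoʳ-< r (subst (_≤ 2 * t) (*-suc 2 i) (*-monoʳ-≤ 2 i<t))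

  below≢offset : ∀ {j} m → j < r → j ≢ r + m
  below≢offset m j<r = <⇒≢ (<-≤-trans j<r (m≤m+n r m))

  position-injective : ∀ {x y} (a : Part x) (b : Part y) → position a ≡ position b → x ≡ y
  position-injective {x} {y} (clique _) (clique _) e = *-cancelˡ-≡ x y 2 (+-cancelˡ-≡ r _ _ e)
  position-injective (clique _) (middle _ j<r _) e = contradiction (sym e) (below≢offset _ j<r)
  position-injective {x} (clique _) (isolated i _ _) e = contradiction (+-cancelˡ-≡ r _ _ e) (even≢odd x i)
  position-injective (middle _ j<r _) (clique _) e = contradiction e (below≢offset _ j<r)
  position-injective (middle _ _ x≡) (middle _ _ y≡) e = trans x≡ (trans (cong (t +_) e) (sym y≡))
  position-injective (middle _ j<r _) (isolated _ _ _) e = contradiction e (below≢offset _ j<r)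
  position-injective {y = y} (isolated i _ _) (clique _) e = contradiction (+-cancelˡ-≡ r _ _ (sym e)) (even≢odd y i)
  position-injective (isolated _ _ _) (middle _ j<r _) e = contradiction (sym e) (below≢offset _ j<r)
  position-injective (isolated i _ x≡) (isolated i′ _ y≡) e =
    trans x≡ (trans (cong (t + r +_) (*-cancelˡ-≡ i i′ 2 (suc-injective (+-cancelˡ-≡ r _ _ e)))) (sym y≡))

  Hadj-cliqueˡ : ∀ {u v} → u ≢ v → inKt n t u ≡ true → Hadj n t u v ≡ true
  Hadj-cliqueˡ {u} {v} u≢v u∈Kt rewrite ⌊⌋-false (u Fin.≟ v) u≢v | u∈Kt = refl

  Hadj-cliqueʳ : ∀ {u v} → u ≢ v → inKt n t v ≡ true → Hadj n t u v ≡ true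
  Hadj-cliqueʳ {u} {v} u≢v v∈Kt = trans (Hadj-sym n t u v) (Hadj-cliqueˡ (≢-sym u≢v) v∈Kt)

  Hadj-middle : ∀ {u v} → u ≢ v → inMid n t u ≡ true → inMid n t v ≡ true → Hadj n t u v ≡ true
  Hadj-middle {u} {v} u≢v u∈Mid v∈Mid
    rewrite ⌊⌋-false (u Fin.≟ v) u≢v | u∈Mid | v∈Mid | ∨-zeroʳ (inKt n t v) = ∨-zeroʳ (inKt n t u)

  clique⇒inKt : ∀ {u} → toℕ u < t → inKt n t u ≡ true
  clique⇒inKt {u} = ⌊⌋-true (toℕ u <? t)

  middle+t<n : ∀ {x} j → j < r → x ≡ t + j → x + t < n
  middle+t<n {x} j j<r x≡ = begin-strict
    x + t       ≡⟨ cong (_+ t) x≡ ⟩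
    t + j + t   <⟨ +-monoˡ-< t (+-monoʳ-< t j<r) ⟩
    t + r + t   ≡⟨ t+r+t≡n ⟩
    n           ∎
    where open ≤-Reasoning

  middle⇒inMid : ∀ {u} j → j < r → toℕ u ≡ t + j → inMid n t u ≡ true
  middle⇒inMid {u} j j<r u≡
    rewrite ⌊⌋-false (toℕ u <? t) (λ u<t → m+n≮m t j (subst (_< t) u≡ u<t))
          | ⌊⌋-true (toℕ u + t <? n) (middle+t<n j j<r u≡) = refl

  successor⇒Hadj : ∀ {u v} → u ≢ v → (a : Part (toℕ u)) (b : Part (toℕ v)) →
                   suc (position a) ≡ position b → Hadj n t u v ≡ true
  successor⇒Hadj u≢v (clique u<t) _ _ = Hadj-cliqueˡ u≢v (clique⇒inKt u<t)
  successor⇒Hadj u≢v _ (clique v<t) _ = Hadj-cliqueʳ u≢v (clique⇒inKt v<t)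
  successor⇒Hadj u≢v (middle j j<r u≡) (middle j′ j′<r v≡) _ =
    Hadj-middle u≢v (middle⇒inMid j j<r u≡) (middle⇒inMid j′ j′<r v≡)
  successor⇒Hadj _ (middle _ j<r _) (isolated i _ _) e =
    contradiction (suc-injective (trans e (+-suc r (2 * i)))) (below≢offset (2 * i) j<r)
  successor⇒Hadj _ (isolated i _ _) (middle _ j<r _) e =
    contradiction (sym (trans (+-suc r (suc (2 * i))) e)) (below≢offset (suc (suc (2 * i))) j<r)
  successor⇒Hadj _ (isolated i _ _) (isolated i′ _ _) e =
    contradiction (sym (suc-injective (+-cancelˡ-≡ r _ _ (trans (+-suc r (suc (2 * i))) e))))
                  (even≢odd i′ i)

  H-hamiltonianPath : HamiltonianPath (H n t)
  H-hamiltonianPath = record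
    { pos           = pos
    ; pos<n         = λ v → position<n (part′ v)
    ; pos-injective = λ {u} {v} e → Finₚ.toℕ-injective (position-injective (part′ u) (part′ v) e)
    ; successor-adj = λ {u} {v} e → successor⇒Hadj (λ { refl → 1+n≢n e }) (part′ u) (part′ v) e
    }
    where
    part′ : (v : Fin n) → Part (toℕ v)
    part′ v = part (toℕ v) (Finₚ.toℕ<n v)
    pos : Fin n → ℕ
    pos v = position (part′ v)

proposition3p1 : (n t : ℕ) → 1 ≤ t → 5 ≤ n → 2 * t ≤ n →
    HasSpanningTreeLeafDist (H n t) 4
proposition3p1 n t _ 5≤n 2t≤n =
  hasSpanningTreeLeafDist-mono {G = H n t} (pred-mono-≤ 5≤n)
    (subst (λ m → HasSpanningTreeLeafDist (H m t) (pred m)) (m∸n+n≡m 2t≤n)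
      (hamiltonianPath⇒spanningTreeLeafDist (H-hamiltonianPath t (n ∸ 2 * t))))
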